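{- Let $d=7$. There is no family of $k=6$ distinct even-size subsets $S_1,\dots,S_6$ of $\{1,\dots,7\}$ such that $|S_\alpha\triangle S_\beta|\ge4$ for all $\alpha\ne\beta$ and such that for every four distinct indices $\alpha,\beta,\gamma,\delta$ there is no $i\in\{1,\dots,7\}$ with $i\in S_\alpha\cap S_\beta\cap S_\gamma\cap S_\delta$ or $i\notin S_\alpha\cup S_\beta\cup S_\gamma\cup S_\delta$ (i.e. all tetrahedral intersection numbers $\dim(M_\alpha\cap M_\beta\cap M_\gamma\cap M_\delta)$ vanish).
   Context: Setting: $\mathbb{C}^{14}$ with a nondegenerate symmetric bilinear form and a canonical null basis $a_1,\dots,a_7,a_1^\dagger,\dots,a_7^\dagger$ ($g(a_i,a_j)=g(a_i^\dagger,a_j^\dagger)=0$, $g(a_i,a_j^\dagger)=\delta_{ij}$). For an even-size subset $S\subseteq\{1,\dots,7\}$, the basis pure semi-spinor $\psi_S=\prod_{i\in S}a_i^\dagger\psi_0$ has null subspace $M(\psi_S)=\mathrm{Span}(\{a_i:i\notin S\}\cup\{a_i^\dagger:i\in S\})$; $M_\alpha$ denotes $M(\psi_{S_\alpha})$. The condition $|S_\alpha\triangle S_\beta|\ge 4$ means pairwise intersections of null subspaces have dimension at most $d-4=3$. -}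

module Defs where

open import Data.Nat using (ℕ; _≥_)
open import Data.Nat.Divisibility using (_∣_)
open import Data.Fin using (Fin)
open import Data.Fin.Subset using (Subset; _∪_; _─_; _∩_; _∈_; _∉_; ∣_∣)
open import Data.Product using (_×_; ∃)
open import Data.Sum using (_⊎_)
open import Relation.Nullary using (¬_)
open import Relation.Binary.PropositionalEquality using (_≡_; _≢_)
open import Function.Definitions using (Injective)

_△_ : ∀ {n} → Subset n → Subset n → Subset n
A △ B = (A ─ B) ∪ (B ─ A)

EvenSubset : ∀ {n} → Subset n → Set
EvenSubset S = 2 ∣ ∣ S ∣

GoodFamily : (Fin 6 → Subset 7) → Set
GoodFamily S =
  Injective _≡_ _≡_ S
  × (∀ α → EvenSubset (S α))
  × (∀ α β → α ≢ β → ∣ S α △ S β ∣ ≥ 4)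
  × (∀ α β γ δ → α ≢ β → α ≢ γ → α ≢ δ → β ≢ γ → β ≢ δ → γ ≢ δ →
       ¬ ∃ (λ (i : Fin 7) →
            (i ∈ (S α ∩ (S β ∩ (S γ ∩ S δ))))
            ⊎ (i ∉ (S α ∪ (S β ∪ (S γ ∪ S δ))))))

-- Fix a coordinate i and look at which of the six sets contain it.  If four
-- of them did, the four would share i; if four of them did not, i would lie
-- outside their union.  So every coordinate lies in exactly three sets, and
-- double counting gives  ∑ ∣ S α ∣ = 7 · 3 = 21,  which is odd although every
-- ∣ S α ∣ is even.
module Submission where

open import Defs
open import Data.Fin using (Fin; zero; suc)
open import Data.Fin.Patterns using (0F; 1F; 2F; 3F)
open import Data.Fin.Properties using (suc-injective)
open import Data.Fin.Subset using (Subset; Side; inside; outside; _∈_; _∉_; _∩_; _∪_; ∁; ∣_∣)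
open import Data.Fin.Subset.Properties using (x∈p∩q⁺; x∈p∪q⁻; x∈∁p⇒x∉p; ∣∁p∣≡n∸∣p∣)
open import Data.Nat using (ℕ; zero; suc; _+_; _∸_; _≤_; s≤s; s≤s⁻¹)
open import Data.Nat.Divisibility using (_∣_; _∣?_; _∣0; ∣m∣n⇒∣m+n)
open import Data.Nat.Properties
  using (+-0-commutativeMonoid; ≰⇒>; ≤-antisym; +-cancelʳ-≤; m≤n+m∸n; +-monoʳ-≤; module ≤-Reasoning)
open import Data.Product using (∃; _×_; _,_)
open import Data.Sum using (_⊎_; inj₁; inj₂; [_,_])
open import Data.Vec using (tabulate; lookup; _∷_; []; here; there)
open import Data.Vec.Properties using (lookup∘tabulate; []=⇒lookup; lookup⇒[]=)
open import Function using (_∘_)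
open import Function.Definitions using (Injective)
open import Relation.Nullary using (¬_)
open import Relation.Nullary.Decidable using (from-no)
open import Relation.Binary.PropositionalEquality using (_≡_; _≢_; refl; sym; trans; cong; subst; module ≡-Reasoning)

open import Algebra.Properties.CommutativeMonoid.Sum +-0-commutativeMonoid
  using (sum-syntax; ∑-comm; sum-cong-≗)

private
  variable
    m n : ℕ

indicator : Side → ℕ
indicator inside  = 1
indicator outside = 0

∣p∣≡∑indicator : (p : Subset n) → ∣ p ∣ ≡ ∑[ i < n ] indicator (lookup p i)
∣p∣≡∑indicator []            = refl
∣p∣≡∑indicator (inside  ∷ p) = cong suc (∣p∣≡∑indicator p)
∣p∣≡∑indicator (outside ∷ p) = ∣p∣≡∑indicator p

∣-∑ : ∀ {d} (f : Fin m → ℕ) → (∀ i → d ∣ f i) → d ∣ ∑[ i < m ] f i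
∣-∑ {zero}  {d} f d∣f = d ∣0
∣-∑ {suc m}     f d∣f = ∣m∣n⇒∣m+n (d∣f zero) (∣-∑ (f ∘ suc) (d∣f ∘ suc))

column : (Fin m → Subset n) → Fin n → Subset m
column S i = tabulate (λ α → lookup (S α) i)

∑∣S∣≡∑∣column∣ : (S : Fin m → Subset n) →
                 ∑[ α < m ] ∣ S α ∣ ≡ ∑[ i < n ] ∣ column S i ∣
∑∣S∣≡∑∣column∣ {m} {n} S = begin
  ∑[ α < m ] ∣ S α ∣                                ≡⟨ sum-cong-≗ (∣p∣≡∑indicator ∘ S) ⟩
  ∑[ α < m ] ∑[ i < n ] indicator (lookup (S α) i)  ≡⟨ ∑-comm {m} {n} _ ⟩
  ∑[ i < n ] ∑[ α < m ] indicator (lookup (S α) i)  ≡⟨ sum-cong-≗ (sym ∘ ∣column∣≡∑) ⟩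
  ∑[ i < n ] ∣ column S i ∣                         ∎
  where
  open ≡-Reasoning
  ∣column∣≡∑ : ∀ i → ∣ column S i ∣ ≡ ∑[ α < m ] indicator (lookup (S α) i)
  ∣column∣≡∑ i = trans (∣p∣≡∑indicator (column S i))
                       (sum-cong-≗ (cong indicator ∘ lookup∘tabulate (λ α → lookup (S α) i)))

module _ (S : Fin m → Subset n) {α : Fin m} {i : Fin n} where

  ∈-column⁻ : α ∈ column S i → i ∈ S α
  ∈-column⁻ α∈ = lookup⇒[]= i (S α)
    (trans (sym (lookup∘tabulate (λ β → lookup (S β) i) α)) ([]=⇒lookup α∈))

  ∈-column⁺ : i ∈ S α → α ∈ column S i
  ∈-column⁺ i∈ = lookup⇒[]= α (column S i)
    (trans (lookup∘tabulate (λ β → lookup (S β) i) α) ([]=⇒lookup i∈))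

≤∣p∣⇒injection : ∀ k (p : Subset n) → k ≤ ∣ p ∣ →
                 ∃ λ (f : Fin k → Fin n) → Injective _≡_ _≡_ f × (∀ j → f j ∈ p)
≤∣p∣⇒injection zero    p             _        = (λ ()) , (λ { {()} }) , (λ ())
≤∣p∣⇒injection (suc k) (outside ∷ p) k<∣p∣    with ≤∣p∣⇒injection (suc k) p k<∣p∣
... | f , f-inj , f∈p = suc ∘ f , f-inj ∘ suc-injective , there ∘ f∈p
≤∣p∣⇒injection (suc k) (inside ∷ p)  (s≤s k≤) with ≤∣p∣⇒injection k p k≤
... | f , f-inj , f∈p = g , g-inj , g∈p
  where
  g : Fin (suc k) → Fin _
  g zero    = zero
  g (suc j) = suc (f j)
  g-inj : Injective _≡_ _≡_ g
  g-inj {zero}  {zero}  _  = refl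
  g-inj {suc x} {suc y} eq = cong suc (f-inj (suc-injective eq))
  g∈p : ∀ j → g j ∈ inside ∷ p
  g∈p zero    = here
  g∈p (suc j) = there (f∈p j)

neither-side-exceeds-half : ∀ {m c} → ¬ suc m ≤ c → ¬ suc m ≤ (m + m) ∸ c → c ≡ m
neither-side-exceeds-half {m} {c} m≱c m≱rest = ≤-antisym c≤m m≤c
  where
  c≤m : c ≤ m
  c≤m = s≤s⁻¹ (≰⇒> m≱c)
  m≤c : m ≤ c
  m≤c = +-cancelʳ-≤ m m c (begin
    m + m            ≤⟨ m≤n+m∸n (m + m) c ⟩
    c + (m + m ∸ c)  ≤⟨ +-monoʳ-≤ c (s≤s⁻¹ (≰⇒> m≱rest)) ⟩
    c + m            ∎)
    where open ≤-Reasoning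

NoTetrahedralPoint : (Fin m → Subset n) → Set
NoTetrahedralPoint S =
  ∀ α β γ δ → α ≢ β → α ≢ γ → α ≢ δ → β ≢ γ → β ≢ δ → γ ≢ δ →
  ¬ ∃ (λ i → (i ∈ (S α ∩ (S β ∩ (S γ ∩ S δ)))) ⊎ (i ∉ (S α ∪ (S β ∪ (S γ ∪ S δ)))))

∉-∪⁺ : ∀ {x : Fin n} {p q} → x ∉ p → x ∉ q → x ∉ p ∪ q
∉-∪⁺ {p = p} {q} x∉p x∉q = [ x∉p , x∉q ] ∘ x∈p∪q⁻ p q

module _ {S : Fin m → Subset n} (no-tet : NoTetrahedralPoint S) (i : Fin n) where

  no-tet-injection : (f : Fin 4 → Fin m) → Injective _≡_ _≡_ f →
    ¬ ((i ∈ (S (f 0F) ∩ (S (f 1F) ∩ (S (f 2F) ∩ S (f 3F)))))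
       ⊎ (i ∉ (S (f 0F) ∪ (S (f 1F) ∪ (S (f 2F) ∪ S (f 3F))))))
  no-tet-injection f f-inj point =
    no-tet _ _ _ _ ((λ ()) ∘ f-inj) ((λ ()) ∘ f-inj) ((λ ()) ∘ f-inj)
                   ((λ ()) ∘ f-inj) ((λ ()) ∘ f-inj) ((λ ()) ∘ f-inj) (i , point)

  4≰∣column∣ : ¬ 4 ≤ ∣ column S i ∣
  4≰∣column∣ 4≤ with ≤∣p∣⇒injection 4 (column S i) 4≤
  ... | f , f-inj , f∈ = no-tet-injection f f-inj (inj₁
    (x∈p∩q⁺ (i∈S 0F , x∈p∩q⁺ (i∈S 1F , x∈p∩q⁺ (i∈S 2F , i∈S 3F)))))
    where
    i∈S : ∀ j → i ∈ S (f j)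
    i∈S = ∈-column⁻ S ∘ f∈

  4≰∣∁column∣ : ¬ 4 ≤ ∣ ∁ (column S i) ∣
  4≰∣∁column∣ 4≤ with ≤∣p∣⇒injection 4 (∁ (column S i)) 4≤
  ... | f , f-inj , f∈ = no-tet-injection f f-inj (inj₂
    (∉-∪⁺ (i∉S 0F) (∉-∪⁺ (i∉S 1F) (∉-∪⁺ (i∉S 2F) (i∉S 3F)))))
    where
    i∉S : ∀ j → i ∉ S (f j)
    i∉S j = x∈∁p⇒x∉p (f∈ j) ∘ ∈-column⁺ S

∣column∣≡3 : {S : Fin 6 → Subset n} → NoTetrahedralPoint S → ∀ i → ∣ column S i ∣ ≡ 3
∣column∣≡3 {S = S} no-tet i = neither-side-exceeds-half (4≰∣column∣ no-tet i)
  (4≰∣∁column∣ no-tet i ∘ subst (4 ≤_) (sym (∣∁p∣≡n∸∣p∣ (column S i))))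

mainTheorem5 : ¬ ∃ (λ (S : Fin 6 → Subset 7) → GoodFamily S)
mainTheorem5 (S , _ , even , _ , no-tet) = from-no (2 ∣? 21) (subst (2 ∣_) ∑∣S∣≡21 (∣-∑ _ even))
  where
  open ≡-Reasoning
  ∑∣S∣≡21 : ∑[ α < 6 ] ∣ S α ∣ ≡ 21
  ∑∣S∣≡21 = begin
    ∑[ α < 6 ] ∣ S α ∣          ≡⟨ ∑∣S∣≡∑∣column∣ S ⟩
    ∑[ i < 7 ] ∣ column S i ∣   ≡⟨ sum-cong-≗ (∣column∣≡3 no-tet) ⟩
    ∑[ i < 7 ] 3                ≡⟨⟩
    21                          ∎
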